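{- Let $q\ge0$ be an integer, let $n\in\{q^2+1,\dots,(q+1)^2\}$, and let $G$ be an $n$-vertex graph containing no cycle of length four. For every vertex $v$ of $G$, $$f(N(v))\ge q\,d(v)-n+1,$$ where $N(v)$ is the neighborhood of $v$.
   Context: For a vertex $u$ of $G$, $d(u)$ is its degree and its deficiency is $f(u)=q+1-d(u)$ (which may be negative); for a set $A$ of vertices, $f(A)=\sum_{u\in A}f(u)$. -}

module Defs where

open import Data.Bool using (Bool; true; false; T)
open import Data.Nat using (ℕ)
open import Data.Fin using (Fin)
open import Data.List using (List; filter; length; map; foldr)
open import Data.Fin.Base using () 
open import Data.List using () renaming (allFin to allFinL)
open import Data.Integer as ℤ using (ℤ; +_)
open import Data.Product using (_×_)
open import Relation.Binary.PropositionalEquality using (_≡_; _≢_)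
open import Relation.Nullary using (¬_)
open import Relation.Nullary.Decidable using (T?)

record Graph (n : ℕ) : Set where
  field
    adj       : Fin n → Fin n → Bool
    adj-sym   : ∀ u v → adj u v ≡ adj v u
    adj-irrefl : ∀ u → adj u u ≡ false
open Graph public

Adj : ∀ {n} → Graph n → Fin n → Fin n → Set
Adj G u v = T (adj G u v)

N : ∀ {n} → Graph n → Fin n → List (Fin n)
N {n} G v = filter (λ w → T? (adj G v w)) (allFinL n)

deg : ∀ {n} → Graph n → Fin n → ℕ
deg G v = length (N G v)

deficiency : ∀ {n} → ℕ → Graph n → Fin n → ℤ
deficiency q G u = + (ℕ.suc q) ℤ.- + (deg G u)
  where import Data.Nat as ℕ

-- f(A) = Σ_{u ∈ A} f(u), for A given as a duplicate-free list
deficiencySet : ∀ {n} → ℕ → Graph n → List (Fin n) → ℤ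
deficiencySet q G A = foldr ℤ._+_ (+ 0) (map (deficiency q G) A)

HasC4 : ∀ {n} → Graph n → Set
HasC4 {n} G = Data.Product.∃ λ (a : Fin n) → Data.Product.∃ λ b → Data.Product.∃ λ c → Data.Product.∃ λ d →
  (a ≢ b × a ≢ c × a ≢ d × b ≢ c × b ≢ d × c ≢ d) ×
  (Adj G a b × Adj G b c × Adj G c d × Adj G d a)
  where import Data.Product

C4Free : ∀ {n} → Graph n → Set
C4Free G = ¬ HasC4 G

{-# OPTIONS --safe #-}
-- Expanding the definition, f(N(v)) = (q+1) d(v) − Σ_{u ∈ N(v)} d(u). The sum counts walks
-- v – u – w, so it equals Σ_w codeg(v,w): the term w = v is d(v), and for w ≠ v a second
-- common neighbour of v and w would close a 4-cycle, so each other term is at most 1.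
-- Hence Σ_{u ∈ N(v)} d(u) < d(v) + n, which rearranges to the claim.
module Submission where

open import Defs
open import Data.Nat using (ℕ; zero; suc; _+_; _*_; _^_; _≤_; _<_; z≤n; s≤s)
open import Data.Fin using (Fin; zero; suc; _≟_; punchIn)
open import Data.Integer using (+_; _-_; +≤+; 0ℤ; 1ℤ) renaming (_≤_ to _≤ℤ_; _*_ to _*ℤ_; _+_ to _+ℤ_)

open import Data.Bool using (Bool; true; false; T; _∧_)
open import Data.Bool.Properties using (∧-idem; T-∧)
open import Data.Empty using (⊥-elim)
open import Data.Fin.Properties using (0≢1+n; suc-injective; punchInᵢ≢i)
import Data.Integer.Properties as ℤ
open import Data.Integer.Tactic.RingSolver using (solve-∀)
open import Data.List using (List; []; _∷_; length; map; tabulate; filterᵇ)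
open import Data.Nat.ListAction using () renaming (sum to sumL)
open import Data.Nat.Properties
  using (+-*-semiring; +-identityʳ; *-identityʳ; +-suc; +-mono-≤; +-monoʳ-≤; ≤-reflexive; module ≤-Reasoning)
open import Data.Product using (_,_)
open import Data.Unit using (tt)
open import Function using (_∘_; Equivalence)
open import Relation.Binary.PropositionalEquality
open import Relation.Nullary using (¬_; yes; no)
open import Algebra.Properties.Semiring.Sum +-*-semiring
  using (sum-syntax; sum-cong-≗; sum-remove; ∑-comm; *-distribˡ-sum)

𝟙 : Bool → ℕ
𝟙 true  = 1
𝟙 false = 0

𝟙-∧ : ∀ a b → 𝟙 a * 𝟙 b ≡ 𝟙 (a ∧ b)
𝟙-∧ true  b = +-identityʳ (𝟙 b)
𝟙-∧ false b = refl

∑≤n : ∀ {n} (f : Fin n → ℕ) → (∀ i → f i ≤ 1) → ∑[ i < n ] f i ≤ n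
∑≤n {zero}  f f≤1 = z≤n
∑≤n {suc n} f f≤1 = +-mono-≤ (f≤1 zero) (∑≤n (f ∘ suc) (f≤1 ∘ suc))

∑<f[v]+n : ∀ {n} (f : Fin n → ℕ) (v : Fin n) → (∀ w → w ≢ v → f w ≤ 1) → ∑[ i < n ] f i < f v + n
∑<f[v]+n {suc n} f v f≤1 = begin-strict
  ∑[ i < suc n ] f i                  ≡⟨ sum-remove f ⟩
  f v + ∑[ i < n ] f (punchIn v i)    ≤⟨ +-monoʳ-≤ (f v) (∑≤n (f ∘ punchIn v) (λ i → f≤1 _ (punchInᵢ≢i v i))) ⟩
  f v + n                             <⟨ ≤-reflexive (sym (+-suc (f v) n)) ⟩
  f v + suc n                         ∎
  where open ≤-Reasoning

𝟙≡0 : ∀ {b} → ¬ T b → 𝟙 b ≡ 0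
𝟙≡0 {true}  ¬b = ⊥-elim (¬b tt)
𝟙≡0 {false} ¬b = refl

∑𝟙≡0 : ∀ {n} (p : Fin n → Bool) → (∀ i → ¬ T (p i)) → ∑[ i < n ] 𝟙 (p i) ≡ 0
∑𝟙≡0 {zero}  p none = refl
∑𝟙≡0 {suc n} p none = cong₂ _+_ (𝟙≡0 (none zero)) (∑𝟙≡0 (p ∘ suc) (none ∘ suc))

∑𝟙≤1 : ∀ {n} (p : Fin n → Bool) → (∀ i j → T (p i) → T (p j) → i ≡ j) → ∑[ i < n ] 𝟙 (p i) ≤ 1
∑𝟙≤1 {zero}  p unique = z≤n
∑𝟙≤1 {suc n} p unique with p zero in p0
... | true  = s≤s (≤-reflexive (∑𝟙≡0 (p ∘ suc) λ i pi → 0≢1+n (unique zero (suc i) (subst T (sym p0) tt) pi)))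
... | false = ∑𝟙≤1 (p ∘ suc) (λ i j pi pj → suc-injective (unique (suc i) (suc j) pi pj))

length≡sum-map-1 : ∀ {A : Set} (xs : List A) → length xs ≡ sumL (map (λ _ → 1) xs)
length≡sum-map-1 []       = refl
length≡sum-map-1 (x ∷ xs) = cong suc (length≡sum-map-1 xs)

sum-map-filterᵇ-tabulate : ∀ {A : Set} {n} (p : A → Bool) (h : A → ℕ) (f : Fin n → A) →
  sumL (map h (filterᵇ p (tabulate f))) ≡ ∑[ i < n ] (𝟙 (p (f i)) * h (f i))
sum-map-filterᵇ-tabulate {n = zero}  p h f = refl
sum-map-filterᵇ-tabulate {n = suc n} p h f with p (f zero)
... | true  = cong₂ _+_ (sym (+-identityʳ (h (f zero)))) (sum-map-filterᵇ-tabulate p h (f ∘ suc))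
... | false = sum-map-filterᵇ-tabulate p h (f ∘ suc)

deg≡∑adj : ∀ {n} (G : Graph n) u → deg G u ≡ ∑[ w < n ] 𝟙 (adj G u w)
deg≡∑adj {n} G u = trans (length≡sum-map-1 (N G u))
  (trans (sum-map-filterᵇ-tabulate (adj G u) (λ _ → 1) (λ w → w)) (sum-cong-≗ {n} λ w → *-identityʳ _))

codeg : ∀ {n} → Graph n → Fin n → Fin n → ℕ
codeg {n} G u w = ∑[ x < n ] 𝟙 (adj G u x ∧ adj G x w)

codeg-self : ∀ {n} (G : Graph n) v → codeg G v v ≡ deg G v
codeg-self G v = trans
  (sum-cong-≗ λ x → trans (cong (λ b → 𝟙 (adj G v x ∧ b)) (adj-sym G x v)) (cong 𝟙 (∧-idem (adj G v x))))
  (sym (deg≡∑adj G v))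

sum-deg-N≡∑codeg : ∀ {n} (G : Graph n) v → sumL (map (deg G) (N G v)) ≡ ∑[ w < n ] codeg G v w
sum-deg-N≡∑codeg {n} G v = begin
  sumL (map (deg G) (N G v))                                  ≡⟨ sum-map-filterᵇ-tabulate (adj G v) (deg G) (λ u → u) ⟩
  ∑[ u < n ] (𝟙 (adj G v u) * deg G u)                        ≡⟨ sum-cong-≗ (λ u → cong (𝟙 (adj G v u) *_) (deg≡∑adj G u)) ⟩
  ∑[ u < n ] (𝟙 (adj G v u) * ∑[ w < n ] 𝟙 (adj G u w))       ≡⟨ sum-cong-≗ (λ u → *-distribˡ-sum {n} (𝟙 (adj G v u)) _) ⟩
  ∑[ u < n ] ∑[ w < n ] (𝟙 (adj G v u) * 𝟙 (adj G u w))       ≡⟨ sum-cong-≗ (λ u → sum-cong-≗ {n} (λ w → 𝟙-∧ (adj G v u) (adj G u w))) ⟩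
  ∑[ u < n ] ∑[ w < n ] 𝟙 (adj G v u ∧ adj G u w)             ≡⟨ ∑-comm {n} {n} _ ⟩
  ∑[ w < n ] codeg G v w                                      ∎
  where open ≡-Reasoning

adj⇒≢ : ∀ {n} (G : Graph n) {a b} → Adj G a b → a ≢ b
adj⇒≢ G {a} a~a refl = subst T (adj-irrefl G a) a~a

adj-symmetric : ∀ {n} (G : Graph n) {a b} → Adj G a b → Adj G b a
adj-symmetric G {a} {b} = subst T (adj-sym G a b)

C4Free⇒codeg≤1 : ∀ {n} (G : Graph n) → C4Free G → ∀ {v w} → w ≢ v → codeg G v w ≤ 1
C4Free⇒codeg≤1 G c4free {v} {w} w≢v = ∑𝟙≤1 (λ x → adj G v x ∧ adj G x w) unique
  where
  unique : ∀ a b → T (adj G v a ∧ adj G a w) → T (adj G v b ∧ adj G b w) → a ≡ b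
  unique a b va∧aw vb∧bw with a ≟ b | Equivalence.to T-∧ va∧aw | Equivalence.to T-∧ vb∧bw
  ... | yes a≡b | _ | _ = a≡b
  ... | no a≢b | v~a , a~w | v~b , b~w = ⊥-elim (c4free (v , a , w , b ,
        (adj⇒≢ G v~a , w≢v ∘ sym , adj⇒≢ G v~b , adj⇒≢ G a~w , a≢b , adj⇒≢ G b~w ∘ sym) ,
        (v~a , a~w , adj-symmetric G b~w , adj-symmetric G v~b)))

C4Free⇒sum-deg-N< : ∀ {n} (G : Graph n) → C4Free G → ∀ v → sumL (map (deg G) (N G v)) < deg G v + n
C4Free⇒sum-deg-N< G c4free v =
  subst₂ (λ s d → s < d + _) (sym (sum-deg-N≡∑codeg G v)) (codeg-self G v)
    (∑<f[v]+n (codeg G v) v (λ w → C4Free⇒codeg≤1 G c4free))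

deficiencySet≡ : ∀ {n} q (G : Graph n) (A : List (Fin n)) →
  deficiencySet q G A ≡ + suc q *ℤ + length A - + sumL (map (deg G) A)
deficiencySet≡ q G []      = sym (nil-identity (+ suc q))
  where
  nil-identity : ∀ a → a *ℤ 0ℤ - 0ℤ ≡ 0ℤ
  nil-identity = solve-∀
deficiencySet≡ q G (u ∷ A) = trans (cong (deficiency q G u +ℤ_) (deficiencySet≡ q G A))
  (cons-identity (+ suc q) (+ deg G u) (+ length A) (+ sumL (map (deg G) A)))
  where
  cons-identity : ∀ a d l s → a - d +ℤ (a *ℤ l - s) ≡ a *ℤ (1ℤ +ℤ l) - (d +ℤ s)
  cons-identity = solve-∀

lemma3p2 : (q n : ℕ) → suc (q ^ 2) ≤ n → n ≤ (suc q) ^ 2 →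
    (G : Graph n) → C4Free G → (v : Fin n) →
    (+ q *ℤ + deg G v) - + n +ℤ + 1 ≤ℤ deficiencySet q G (N G v)
lemma3p2 q n _ _ G c4free v = begin
  + q *ℤ + d - + n +ℤ 1ℤ                ≡⟨ add-and-subtract (+ q) (+ d) (+ n) (+ D) ⟩
  (+ q *ℤ + d - + n - + D) +ℤ + suc D   ≤⟨ ℤ.+-monoʳ-≤ (+ q *ℤ + d - + n - + D) (+≤+ (C4Free⇒sum-deg-N< G c4free v)) ⟩
  (+ q *ℤ + d - + n - + D) +ℤ + (d + n) ≡⟨ collect (+ q) (+ d) (+ n) (+ D) ⟩
  + suc q *ℤ + d - + D                  ≡⟨ sym (deficiencySet≡ q G (N G v)) ⟩
  deficiencySet q G (N G v)             ∎
  where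
  open ℤ.≤-Reasoning
  d D : ℕ
  d = deg G v
  D = sumL (map (deg G) (N G v))
  add-and-subtract : ∀ q d n D → q *ℤ d - n +ℤ 1ℤ ≡ (q *ℤ d - n - D) +ℤ (1ℤ +ℤ D)
  add-and-subtract = solve-∀
  collect : ∀ q d n D → (q *ℤ d - n - D) +ℤ (d +ℤ n) ≡ (1ℤ +ℤ q) *ℤ d - D
  collect = solve-∀
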